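{- Let $(U,\rho)$ be a finite metric space and let $T$ be a 2-HST of $U$ (as described in the context). Let $C_1$ be the set of $k$ subtree roots produced by the subtree-search phase of the NDP-HST initialization. Then $$\mathrm{cost}'^{T}_k(U)\le 5\,\mathrm{OPT}^T_k(U).$$
   Context: $(U,\rho)$ is a finite metric space with $|U|=n$, minimum interpoint distance $1$ and diameter $\Delta$; $L=\log_2\Delta$ is assumed to be an integer. A 2-HST of $U$ is a rooted tree $T$ whose nodes are subsets (clusters) of $U$, obtained by recursive padded decompositions: the root has level $L$; the children of a node at level $i$ are at level $i-1$ and partition its cluster into pieces of diameter at most $\Delta/2^{L-i+1}$; the leaves are in one-to-one correspondence with the points of $U$ (each leaf contains exactly one point). Levels decrease down the tree; $h_v$ denotes the level of node $v$, $T(v)$ the subtree rooted at $v$. The tree metric $\rho^T(x,y)$ between points $x,y\in U$ is the weighted path distance between their leaves in $T$, where an edge joining a node at level $i$ to its child at level $i-1$ has weight $2^{i-1}$. NDP-HST initialization: for every node $v$ let $N_v=|U\cap T(v)|$ and $\mathrm{score}(v)=N_v\cdot 2^{h_v}$. Subtree search: start with $C_1=\emptyset$; while $|C_1|<k$, add to $C_1$ the $k-|C_1|$ highest-score nodes (never re-selecting nodes in $C_1$ or their ancestors), and then remove from $C_1$ every node that has a descendant in $C_1$. The result $C_1$ consists of $k$ nodes with pairwise disjoint subtrees. Leaf search (FIND-LEAF): for each $v\in C_1$, repeatedly replace $v$ by its child $w$ with largest $N_w$ until a leaf is reached; $C_0$ is the set of $k$ points at the resulting leaves. Costs: $\mathrm{cost}^T_k(U)=\sum_{y\in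 U}\min_{x\in C_0}\rho^T(x,y)$; $\mathrm{cost}'^T_k(U)=\min\{\sum_{y\in U}\min_{x\in F}\rho^T(x,y): F\subseteq U,\ |F\cap T(v)|=1\ \forall v\in C_1\}$; $\mathrm{OPT}^T_k(U)=\min_{F\subseteq U,|F|=k}\sum_{y\in U}\min_{x\in F}\rho^T(x,y)$. -}

module Defs where

open import Data.Nat using (ℕ; zero; suc; _+_; _*_; _^_; _≤_; _<_; _∸_; _⊓_)
open import Data.Fin using (Fin; _≟_)
open import Data.List using (List; []; _∷_; _++_; length; map; foldr; allFin)
open import Data.Nat.ListAction using (sum)
open import Data.List.NonEmpty using (List⁺; _∷_; toList)
open import Data.List.Membership.Propositional using (_∈_; _∉_)
open import Data.List.Membership.DecPropositional using () renaming (_∈?_ to mem?)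
open import Data.List.Relation.Unary.Unique.Propositional using (Unique)
open import Data.Maybe using (Maybe; just; nothing; Is-just)
open import Data.Product using (Σ; ∃; _×_; _,_; proj₁)
open import Data.Bool using (if_then_else_; _∧_)
open import Relation.Nullary using (¬_; does)
open import Relation.Binary.PropositionalEquality using (_≡_; _≢_)
open import Function.Bundles using (_⇔_)

-- Leaves are at level 0 and carry one
-- point of U; an internal node of level (suc h) has a non-empty list of
-- children, all of level h.  (Levels are shifted so that the leaves are at
-- level 0.)  The edge from a node of level i to a child of
-- level i-1 has weight 2^(i-1).

data Tree (n : ℕ) : ℕ → Set where
  leaf : Fin n → Tree n 0
  node : ∀ {h} → List⁺ (Tree n h) → Tree n (suc h)

mutual
  pts : ∀ {n h} → Tree n h → List (Fin n)
  pts (leaf x) = x ∷ []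
  pts (node (c ∷ cs)) = pts c ++ ptsL cs

  ptsL : ∀ {n h} → List (Tree n h) → List (Fin n)
  ptsL [] = []
  ptsL (c ∷ cs) = pts c ++ ptsL cs

LeafBijection : ∀ {n h} → Tree n h → Set
LeafBijection {n} t = Unique (pts t) × (∀ (x : Fin n) → x ∈ pts t)

bothIn : ∀ {n h} → Fin n → Fin n → Tree n h → Data.Bool.Bool
bothIn x y t = does (mem? _≟_ x (pts t)) ∧ does (mem? _≟_ y (pts t))

mutual
  lcaLevel : ∀ {n h} → Tree n h → Fin n → Fin n → ℕ
  lcaLevel (leaf z) x y = 0
  lcaLevel {h = suc h} (node (c ∷ cs)) x y = lcaL (suc h) (c ∷ cs) x y

  lcaL : ∀ {n h} → ℕ → List (Tree n h) → Fin n → Fin n → ℕ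
  lcaL d [] x y = d
  lcaL d (c ∷ cs) x y = if bothIn x y c then lcaLevel c x y else lcaL d cs x y

-- weight of the path from a leaf up to an ancestor of level h:
-- 2^0 + 2^1 + ... + 2^(h-1)
upCost : ℕ → ℕ
upCost zero = 0
upCost (suc h) = upCost h + 2 ^ h

ρT : ∀ {n h} → Tree n h → Fin n → Fin n → ℕ
ρT t x y = 2 * upCost (lcaLevel t x y)

-- minimum of a list of naturals (only used on non-empty lists; [] ↦ 0)
minList : List ℕ → ℕ
minList [] = 0
minList (a ∷ as) = foldr _⊓_ a as

cost : ∀ {n h} → Tree n h → List (Fin n) → ℕ
cost {n} t F = sum (map (λ y → minList (map (λ x → ρT t x y) F)) (allFin n))

-- Nodes of T, addressed by the path of child indices from the root.

Address : Set
Address = List ℕ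

nth : ∀ {A : Set} → List A → ℕ → Maybe A
nth [] i = nothing
nth (a ∷ as) zero = just a
nth (a ∷ as) (suc i) = nth as i

subAt : ∀ {n h} → Tree n h → Address → Maybe (Σ ℕ (Tree n))
subAt t [] = just (_ , t)
subAt (leaf x) (i ∷ a) = nothing
subAt (node cs) (i ∷ a) with nth (toList cs) i
... | nothing = nothing
... | just c = subAt c a

IsNode : ∀ {n h} → Tree n h → Address → Set
IsNode t v = Is-just (subAt t v)

-- level h_v and cluster U ∩ T(v) of the node at address v
-- (defaults for invalid addresses are never used)
levelAt : ∀ {n h} → Tree n h → Address → ℕ
levelAt t v with subAt t v
... | nothing = 0
... | just (l , s) = l

clusterAt : ∀ {n h} → Tree n h → Address → List (Fin n)
clusterAt t v with subAt t v
... | nothing = []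
... | just (l , s) = pts s

Nv : ∀ {n h} → Tree n h → Address → ℕ
Nv t v = length (clusterAt t v)

score : ∀ {n h} → Tree n h → Address → ℕ
score t v = Nv t v * 2 ^ levelAt t v

ProperAncestor : Address → Address → Set
ProperAncestor u w = ∃ λ c → c ≢ [] × u ++ c ≡ w

-- Subtree search of NDP-HST (any tie-breaking among equal scores).

Eligible : ∀ {n h} → Tree n h → List Address → Address → Set
Eligible t C v = IsNode t v × v ∉ C × (∀ w → w ∈ C → ¬ ProperAncestor v w)

record SearchStep {n h} (t : Tree n h) (k : ℕ) (C C' : List Address) : Set where
  field
    loopGuard  : length C < k
    S          : List Address
    S-unique   : Unique S
    S-size     : length S ≡ k ∸ length C
    S-eligible : ∀ v → v ∈ S → Eligible t C v
    S-highest  : ∀ v u → Eligible t C v → v ∉ S → u ∈ S → score t v ≤ score t u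
    C'-unique  : Unique C'
    C'-spec    : ∀ v → (v ∈ C') ⇔ (v ∈ C ++ S × ¬ (∃ λ w → w ∈ C ++ S × ProperAncestor v w))

data SearchRun {n h} (t : Tree n h) (k : ℕ) : List Address → Set where
  start : SearchRun t k []
  step  : ∀ {C C'} → SearchRun t k C → SearchStep t k C C' → SearchRun t k C'

SubtreeSearch : ∀ {n h} → Tree n h → ℕ → List Address → Set
SubtreeSearch t k C₁ = SearchRun t k C₁ × ¬ (length C₁ < k)

module Submission where

-- In a 2-HST a point y pays 2(2^0 + ⋯ + 2^{h-1}) to reach its nearest centre, where h is the level
-- of its lowest ancestor meeting the centre set F.  Summing over points, the cost of F is twice its
-- missed mass: the sum of N_s·2^{h_s} over the nodes s whose cluster misses F.
-- Let m be the least score in C₁.  The search guarantees that every node lying above no member of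
-- C₁ scores at most m.  Given a k-set G, let F pick in each cluster of C₁ a point of G when there
-- is one.  A node missed by F but hit by G lies above no member of C₁, so its whole subtree adds at
-- most 2m to the missed mass of F, and it contains a point of G outside F.  As |G| = k ≤ |C₁|, there
-- are no more such points than members of C₁ missed by G, each adding at least m to the missed mass
-- of G.  So F, and hence the best F, costs at most 3·cost(G).

open import Defs
open import Data.Fin using (Fin) renaming (_≟_ to _≟ᶠ_)
open import Data.List using (List; []; _∷_; _++_; length; map; filter; concatMap; allFin; foldr; cartesianProductWith)
open import Data.List.NonEmpty using (_∷_; toList)
open import Data.List.Properties using (map-++; map-cong-local; length-filter; filter-some; filter-++; length-++; length-map; ++-identityʳ; ++-assoc; ∷-injective)
open import Data.List.Extrema.Nat using (argmin; argmax; argmin-sel; argmax-all; f[argmin]≤f[xs]; f[xs]≤f[argmax])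
open import Data.List.Membership.Propositional using (_∈_; _∉_; lose; find)
open import Data.List.Membership.DecPropositional using () renaming (_∈?_ to ∈?-by)
open import Data.List.Membership.Propositional.Properties using (∈-++⁺ˡ; ∈-++⁺ʳ; ∈-++⁻; ∈-map⁺; ∈-map⁻; ∈-filter⁺; ∈-filter⁻; ∈-concat⁻′; ∈-allFin; ∈-cartesianProductWith⁺; ∈-cartesianProductWith⁻)
open import Data.List.Membership.Propositional.Properties.WithK using (unique∧set⇒bag)
open import Data.List.Relation.Binary.BagAndSetEquality using (∼bag⇒↭)
open import Data.List.Relation.Binary.Disjoint.Propositional using (Disjoint)
open import Data.List.Relation.Binary.Permutation.Propositional using (_↭_)
open import Data.List.Relation.Binary.Permutation.Propositional.Properties using (↭-length; map⁺)
open import Data.List.Relation.Binary.Pointwise using (Pointwise; []; _∷_)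
open import Data.List.Relation.Binary.Subset.Propositional using (_⊆_)
open import Data.List.Relation.Unary.All as All using ([]; _∷_)
import Data.List.Relation.Unary.All.Properties as All
open import Data.List.Relation.Unary.AllPairs using ([]; _∷_)
open import Data.List.Relation.Unary.Any using (Any; here; there; any?)
import Data.List.Relation.Unary.Any.Properties as Any
open import Data.List.Relation.Unary.Unique.Propositional using (Unique)
import Data.List.Relation.Unary.Unique.Propositional.Properties as Unique
open import Data.Maybe using (just; nothing; Is-just)
import Data.Maybe.Relation.Unary.Any as Maybe
open import Data.Nat using (ℕ; zero; suc; _≟_; _+_; _*_; _^_; _≤_; _<_; _⊓_; z≤n; s≤s)
open import Data.Nat.ListAction using (sum)
open import Data.Nat.ListAction.Properties using (sum-++; sum-↭)
open import Data.Nat.Properties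
open import Algebra.Properties.CommutativeSemigroup +-commutativeSemigroup using () renaming (interchange to +-interchange)
open import Data.Product using (∃; _×_; _,_; proj₁; proj₂)
open import Data.Sum using (_⊎_; inj₁; inj₂; [_,_]; map₁)
open import Function using (_∘_; const; id)
open import Function.Bundles using (Equivalence; mk⇔)
open import Relation.Binary.Definitions using (DecidableEquality)
open import Relation.Binary.PropositionalEquality using (_≡_; _≢_; refl; sym; trans; cong; cong₂; subst; subst₂; module ≡-Reasoning)
open import Relation.Nullary using (¬_; Dec; yes; no; does; contradiction)
open import Relation.Nullary.Decidable using (_×-dec_; ¬?; toSum)
open import Relation.Unary using (Decidable)

private
  variable
    A B : Set
    n h h′ : ℕ

-- Lists

Unique-++⁻ : ∀ (xs : List A) {ys} → Unique (xs ++ ys) → Unique xs × Unique ys × Disjoint xs ys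
Unique-++⁻ [] ys! = [] , ys! , λ ()
Unique-++⁻ (x ∷ xs) (x∉ ∷ xs++ys!) with Unique-++⁻ xs xs++ys!
... | xs! , ys! , xs#ys = All.++⁻ˡ xs x∉ ∷ xs! , ys! , λ where
  (here refl , v∈ys) → All.lookup (All.++⁻ʳ xs x∉) v∈ys refl
  (there v∈xs , v∈ys) → xs#ys (v∈xs , v∈ys)

Unique-map⁺-locally : ∀ (f : A → B) {xs} → Unique xs →
                      (∀ {x y} → x ∈ xs → y ∈ xs → f x ≡ f y → x ≡ y) → Unique (map f xs)
Unique-map⁺-locally f [] inj = []
Unique-map⁺-locally f {x ∷ xs} (x∉ ∷ xs!) inj =
  All.tabulate fresh ∷ Unique-map⁺-locally f xs! (λ x∈ y∈ → inj (there x∈) (there y∈))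
  where
  fresh : ∀ {z} → z ∈ map f xs → f x ≢ z
  fresh z∈ fx≡z with ∈-map⁻ f z∈
  ... | y , y∈ , refl = All.lookup x∉ y∈ (inj (here refl) (there y∈) fx≡z)

Unique-concatMap⁺ : ∀ (f : A → List B) {xs} → Unique xs → (∀ {x} → x ∈ xs → Unique (f x)) →
                    (∀ {x y z} → x ∈ xs → y ∈ xs → z ∈ f x → z ∈ f y → x ≡ y) → Unique (concatMap f xs)
Unique-concatMap⁺ f [] _ _ = []
Unique-concatMap⁺ f {x ∷ xs} (x∉ ∷ xs!) f! f# =
  Unique.++⁺ (f! (here refl)) (Unique-concatMap⁺ f xs! (f! ∘ there) (λ x∈ y∈ → f# (there x∈) (there y∈))) fresh
  where
  fresh : Disjoint (f x) (concatMap f xs)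
  fresh (z∈fx , z∈rest) with ∈-concat⁻′ (map f xs) z∈rest
  ... | _ , z∈fy , fy∈ with ∈-map⁻ f fy∈
  ...   | y , y∈xs , refl = All.lookup x∉ y∈xs (f# (here refl) (there y∈xs) z∈fx z∈fy)

choices : (B → List A) → List B → List (List A)
choices f [] = [] ∷ []
choices f (b ∷ bs) = cartesianProductWith _∷_ (f b) (choices f bs)

∈-choices⁺ : ∀ (f : B → List A) {bs as} → Pointwise (λ b a → a ∈ f b) bs as → as ∈ choices f bs
∈-choices⁺ f [] = here refl
∈-choices⁺ f (a∈ ∷ as∈) = ∈-cartesianProductWith⁺ _∷_ a∈ (∈-choices⁺ f as∈)

∈-choices⁻ : ∀ (f : B → List A) bs {as} → as ∈ choices f bs → Pointwise (λ b a → a ∈ f b) bs as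
∈-choices⁻ f [] (here refl) = []
∈-choices⁻ f (b ∷ bs) as∈ with ∈-cartesianProductWith⁻ _∷_ (f b) (choices f bs) as∈
... | _ , _ , a∈ , as′∈ , refl = a∈ ∷ ∈-choices⁻ f bs as′∈

∈-++-∉ˡ : ∀ (xs : List A) {ys x} → x ∉ xs → x ∈ xs ++ ys → x ∈ ys
∈-++-∉ˡ xs x∉xs x∈ = [ (λ x∈xs → contradiction x∈xs x∉xs) , id ] (∈-++⁻ xs x∈)

length-filter-¬ : ∀ {P : A → Set} (P? : Decidable P) xs →
                  length (filter P? xs) + length (filter (¬? ∘ P?) xs) ≡ length xs
length-filter-¬ P? [] = refl
length-filter-¬ P? (x ∷ xs) with P? x
... | yes _ = cong suc (length-filter-¬ P? xs)
... | no _ = trans (+-suc _ _) (cong suc (length-filter-¬ P? xs))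

module _ (f : A → ℕ) where

  sum-map-cong : ∀ {g} xs → (∀ {x} → x ∈ xs → f x ≡ g x) → sum (map f xs) ≡ sum (map g xs)
  sum-map-cong xs f≡g = cong sum (map-cong-local (All.tabulate f≡g))

  sum-map-mono : ∀ {g} xs → (∀ {x} → x ∈ xs → f x ≤ g x) → sum (map f xs) ≤ sum (map g xs)
  sum-map-mono [] f≤g = z≤n
  sum-map-mono (x ∷ xs) f≤g = +-mono-≤ (f≤g (here refl)) (sum-map-mono xs (f≤g ∘ there))

  sum-map-++ : ∀ xs ys → sum (map f (xs ++ ys)) ≡ sum (map f xs) + sum (map f ys)
  sum-map-++ xs ys = trans (cong sum (map-++ f xs ys)) (sum-++ (map f xs) (map f ys))

  sum-map-*ˡ : ∀ c xs → sum (map (λ x → c * f x) xs) ≡ c * sum (map f xs)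
  sum-map-*ˡ c [] = sym (*-zeroʳ c)
  sum-map-*ˡ c (x ∷ xs) = trans (cong (c * f x +_) (sum-map-*ˡ c xs)) (sym (*-distribˡ-+ c (f x) _))

  sum-map-filter : ∀ {P : A → Set} (P? : Decidable P) xs → sum (map f (filter P? xs)) ≤ sum (map f xs)
  sum-map-filter P? [] = z≤n
  sum-map-filter P? (x ∷ xs) with P? x
  ... | yes _ = +-monoʳ-≤ (f x) (sum-map-filter P? xs)
  ... | no _ = ≤-trans (sum-map-filter P? xs) (m≤n+m _ (f x))

  sum-map-concatMap : ∀ (g : B → List A) xs →
                      sum (map f (concatMap g xs)) ≡ sum (map (λ x → sum (map f (g x))) xs)
  sum-map-concatMap g [] = refl
  sum-map-concatMap g (x ∷ xs) = trans (sum-map-++ (g x) (concatMap g xs)) (cong (sum (map f (g x)) +_) (sum-map-concatMap g xs))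

sum-map-+ : ∀ (f g : A → ℕ) xs → sum (map (λ x → f x + g x) xs) ≡ sum (map f xs) + sum (map g xs)
sum-map-+ f g [] = refl
sum-map-+ f g (x ∷ xs) = trans (cong (f x + g x +_) (sum-map-+ f g xs)) (+-interchange (f x) (g x) _ _)

sum-map-const : ∀ c (xs : List A) → sum (map (const c) xs) ≡ length xs * c
sum-map-const c [] = refl
sum-map-const c (x ∷ xs) = cong (c +_) (sum-map-const c xs)

module _ (_≟_ : DecidableEquality A) where

  private
    _∈?_ = ∈?-by _≟_

  ↭-filter-∈ : ∀ {xs ys} → Unique xs → Unique ys → xs ⊆ ys → xs ↭ filter (_∈? xs) ys
  ↭-filter-∈ {xs} {ys} xs! ys! xs⊆ys = ∼bag⇒↭ (unique∧set⇒bag xs! (Unique.filter⁺ (_∈? xs) ys!)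
    (mk⇔ (λ x∈ → ∈-filter⁺ (_∈? xs) (xs⊆ys x∈) x∈) (proj₂ ∘ ∈-filter⁻ (_∈? xs) {xs = ys})))

  sum-map-⊆ : ∀ (f : A → ℕ) {xs ys} → Unique xs → Unique ys → xs ⊆ ys → sum (map f xs) ≤ sum (map f ys)
  sum-map-⊆ f {xs} {ys} xs! ys! xs⊆ys = begin
    sum (map f xs)                    ≡⟨ sum-↭ (map⁺ f (↭-filter-∈ xs! ys! xs⊆ys)) ⟩
    sum (map f (filter (_∈? xs) ys))  ≤⟨ sum-map-filter f (_∈? xs) ys ⟩
    sum (map f ys)                    ∎
    where open ≤-Reasoning

  length-⊆ : ∀ {xs ys} → Unique xs → Unique ys → xs ⊆ ys → length xs ≤ length ys
  length-⊆ {xs} {ys} xs! ys! xs⊆ys = begin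
    length xs                    ≡⟨ ↭-length (↭-filter-∈ xs! ys! xs⊆ys) ⟩
    length (filter (_∈? xs) ys)  ≤⟨ length-filter (_∈? xs) ys ⟩
    length ys                    ∎
    where open ≤-Reasoning

minList-≤ : ∀ {x} xs → x ∈ xs → minList xs ≤ x
minList-≤ (a ∷ as) x∈ = go a as x∈
  where
  go : ∀ {x} a as → x ∈ a ∷ as → foldr _⊓_ a as ≤ x
  go a [] (here refl) = ≤-refl
  go a (b ∷ bs) (here refl) = ≤-trans (m⊓n≤n b _) (go a bs (here refl))
  go a (b ∷ bs) (there (here refl)) = m⊓n≤m b _
  go a (b ∷ bs) (there (there x∈)) = ≤-trans (m⊓n≤n b _) (go a bs (there x∈))

≤-minList : ∀ {z x₀} xs → x₀ ∈ xs → (∀ {x} → x ∈ xs → z ≤ x) → z ≤ minList xs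
≤-minList (a ∷ as) _ z≤ = go a as z≤
  where
  go : ∀ {z} a as → (∀ {x} → x ∈ a ∷ as → z ≤ x) → z ≤ foldr _⊓_ a as
  go a [] z≤ = z≤ (here refl)
  go a (b ∷ bs) z≤ = ⊓-glb (z≤ (there (here refl))) (go a bs λ where
    (here refl) → z≤ (here refl)
    (there x∈) → z≤ (there (there x∈)))

-- Addresses

infix 4 _⊑_

_⊑_ : Address → Address → Set
u ⊑ v = ∃ λ d → u ++ d ≡ v

⊑-refl : ∀ u → u ⊑ u
⊑-refl u = [] , ++-identityʳ u

⊑-trans : ∀ {u v w} → u ⊑ v → v ⊑ w → u ⊑ w
⊑-trans {u} (d , refl) (e , refl) = d ++ e , sym (++-assoc u d e)

ProperAncestor⇒⊑ : ∀ {u v} → ProperAncestor u v → u ⊑ v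
ProperAncestor⇒⊑ (d , _ , eq) = d , eq

⊑⇒≡⊎ProperAncestor : ∀ {u v} → u ⊑ v → u ≡ v ⊎ ProperAncestor u v
⊑⇒≡⊎ProperAncestor {u} ([] , eq) = inj₁ (trans (sym (++-identityʳ u)) eq)
⊑⇒≡⊎ProperAncestor (i ∷ d , eq) = inj₂ (i ∷ d , (λ ()) , eq)

ProperAncestor⇒length< : ∀ {u v} → ProperAncestor u v → length u < length v
ProperAncestor⇒length< {u} ([] , d≢[] , _) = contradiction refl d≢[]
ProperAncestor⇒length< {u} (i ∷ d , _ , refl) = begin-strict
  length u                   <⟨ m<m+n (length u) (s≤s z≤n) ⟩
  length u + length (i ∷ d)  ≡⟨ length-++ u ⟨
  length (u ++ i ∷ d)        ∎
  where open ≤-Reasoning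

_⊑?_ : ∀ u v → Dec (u ⊑ v)
[] ⊑? v = yes (v , refl)
(i ∷ u) ⊑? [] = no λ ()
(i ∷ u) ⊑? (j ∷ v) with i ≟ j | u ⊑? v
... | yes refl | yes (d , eq) = yes (d , cong (i ∷_) eq)
... | yes refl | no u⋢v = no λ (d , eq) → u⋢v (d , proj₂ (∷-injective eq))
... | no i≢j | _ = no λ (d , eq) → i≢j (proj₁ (∷-injective eq))

-- Clusters and subtrees

_∈?_ : ∀ (x : Fin n) xs → Dec (x ∈ xs)
x ∈? xs = ∈?-by _≟ᶠ_ x xs

weight : Tree n h → ℕ
weight {h = h} t = length (pts t) * 2 ^ h

pts-nonempty : ∀ (t : Tree n h) → ∃ (_∈ pts t)
pts-nonempty (leaf x) = x , here refl
pts-nonempty (node (c ∷ cs)) with pts-nonempty c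
... | x , x∈c = x , ∈-++⁺ˡ x∈c

∈⇒nth : ∀ {x} {xs : List A} → x ∈ xs → ∃ λ i → nth xs i ≡ just x
∈⇒nth (here refl) = 0 , refl
∈⇒nth (there x∈) with ∈⇒nth x∈
... | i , eq = suc i , eq

nth-pts-⊆ : ∀ (cs : List (Tree n h)) i {c} → nth cs i ≡ just c → pts c ⊆ ptsL cs
nth-pts-⊆ (c ∷ cs) zero refl = ∈-++⁺ˡ
nth-pts-⊆ (c ∷ cs) (suc i) eq = ∈-++⁺ʳ (pts c) ∘ nth-pts-⊆ cs i eq

nth-Unique : ∀ (cs : List (Tree n h)) i {c} → nth cs i ≡ just c → Unique (ptsL cs) → Unique (pts c)
nth-Unique (c ∷ cs) zero refl cs! = proj₁ (Unique-++⁻ (pts c) cs!)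
nth-Unique (c ∷ cs) (suc i) eq cs! = nth-Unique cs i eq (proj₁ (proj₂ (Unique-++⁻ (pts c) cs!)))

nth-pts-disjoint : ∀ (cs : List (Tree n h)) i j {c c′ x} → Unique (ptsL cs) →
                   nth cs i ≡ just c → nth cs j ≡ just c′ → x ∈ pts c → x ∈ pts c′ → i ≡ j
nth-pts-disjoint (c ∷ cs) zero zero _ _ _ _ _ = refl
nth-pts-disjoint (c ∷ cs) zero (suc j) cs! refl eq′ x∈ x∈′ =
  contradiction (x∈ , nth-pts-⊆ cs j eq′ x∈′) (proj₂ (proj₂ (Unique-++⁻ (pts c) cs!)))
nth-pts-disjoint (c ∷ cs) (suc i) zero cs! eq refl x∈ x∈′ =
  contradiction (x∈′ , nth-pts-⊆ cs i eq x∈) (proj₂ (proj₂ (Unique-++⁻ (pts c) cs!)))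
nth-pts-disjoint (c ∷ cs) (suc i) (suc j) cs! eq eq′ x∈ x∈′ =
  cong suc (nth-pts-disjoint cs i j (proj₁ (proj₂ (Unique-++⁻ (pts c) cs!))) eq eq′ x∈ x∈′)

subAt-child : ∀ cs i u {c : Tree n h} → nth (toList cs) i ≡ just c → subAt (node cs) (i ∷ u) ≡ subAt c u
subAt-child cs i u eq with nth (toList cs) i
subAt-child cs i u refl | just _ = refl

subAt-++ : ∀ (t : Tree n h) u v {s : Tree n h′} → subAt t u ≡ just (h′ , s) → subAt t (u ++ v) ≡ subAt s v
subAt-++ t [] v refl = refl
subAt-++ (node cs) (i ∷ u) v eq with nth (toList cs) i
... | just c = subAt-++ c u v eq

subAt-pts-⊆ : ∀ (t : Tree n h) u {s : Tree n h′} → subAt t u ≡ just (h′ , s) → pts s ⊆ pts t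
subAt-pts-⊆ t [] refl = id
subAt-pts-⊆ (node (c ∷ cs)) (i ∷ u) eq with nth (c ∷ cs) i in nth≡
... | just c′ = nth-pts-⊆ (c ∷ cs) i nth≡ ∘ subAt-pts-⊆ c′ u eq

subAt-Unique : ∀ (t : Tree n h) u {s : Tree n h′} → subAt t u ≡ just (h′ , s) → Unique (pts t) → Unique (pts s)
subAt-Unique t [] refl t! = t!
subAt-Unique (node (c ∷ cs)) (i ∷ u) eq t! with nth (c ∷ cs) i in nth≡
... | just c′ = subAt-Unique c′ u eq (nth-Unique (c ∷ cs) i nth≡ t!)

subAt-comparable : ∀ (t : Tree n h) u v {h₁ h₂} {s₁ : Tree n h₁} {s₂ : Tree n h₂} {x} → Unique (pts t) →
                   subAt t u ≡ just (h₁ , s₁) → subAt t v ≡ just (h₂ , s₂) →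
                   x ∈ pts s₁ → x ∈ pts s₂ → u ⊑ v ⊎ v ⊑ u
subAt-comparable t [] v _ _ _ _ _ = inj₁ (v , refl)
subAt-comparable t (i ∷ u) [] _ _ _ _ _ = inj₂ (i ∷ u , refl)
subAt-comparable (node (c ∷ cs)) (i ∷ u) (j ∷ v) t! eq₁ eq₂ x∈₁ x∈₂
  with nth (c ∷ cs) i in nth≡ᵢ | nth (c ∷ cs) j in nth≡ⱼ
... | just cᵢ | just cⱼ
  with refl ← nth-pts-disjoint (c ∷ cs) i j t! nth≡ᵢ nth≡ⱼ
                 (subAt-pts-⊆ cᵢ u eq₁ x∈₁) (subAt-pts-⊆ cⱼ v eq₂ x∈₂)
  with refl ← trans (sym nth≡ᵢ) nth≡ⱼ
  with subAt-comparable cᵢ u v (nth-Unique (c ∷ cs) i nth≡ᵢ t!) eq₁ eq₂ x∈₁ x∈₂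
... | inj₁ (d , eq) = inj₁ (d , cong (i ∷_) eq)
... | inj₂ (d , eq) = inj₂ (d , cong (i ∷_) eq)

clusterAt-subAt : ∀ (t : Tree n h) u {s : Tree n h′} → subAt t u ≡ just (h′ , s) → clusterAt t u ≡ pts s
clusterAt-subAt t u eq with subAt t u
clusterAt-subAt t u refl | just _ = refl

clusterAt-⊆ : ∀ (t : Tree n h) u → clusterAt t u ⊆ pts t
clusterAt-⊆ t u with subAt t u in eq
... | nothing = λ ()
... | just _ = subAt-pts-⊆ t u eq

score-subAt : ∀ (t : Tree n h) u {s : Tree n h′} → subAt t u ≡ just (h′ , s) → score t u ≡ weight s
score-subAt t u eq with subAt t u
score-subAt t u refl | just _ = refl

infix 4 _≼_

data _≼_ {n} : Tree n h′ → Tree n h → Set where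
  ≼-refl  : {t : Tree n h} → t ≼ t
  ≼-child : ∀ {s : Tree n h′} {c : Tree n h} {cs} → s ≼ c → c ∈ toList cs → s ≼ node cs

≼⇒subAt : ∀ {s : Tree n h′} {t : Tree n h} → s ≼ t → ∃ λ u → subAt t u ≡ just (h′ , s)
≼⇒subAt ≼-refl = [] , refl
≼⇒subAt (≼-child {cs = cs} s≼c c∈cs) with ∈⇒nth c∈cs | ≼⇒subAt s≼c
... | i , nth≡ | u , eq = i ∷ u , trans (subAt-child cs i u nth≡) eq

-- Missed mass

Hits : List (Fin n) → List (Fin n) → Set
Hits F xs = Any (_∈ F) xs

hits? : ∀ (F xs : List (Fin n)) → Dec (Hits F xs)
hits? F = any? (_∈? F)

unless : {P : Set} → Dec P → ℕ → ℕ
unless (yes _) w = 0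
unless (no _) w = w

unless-yes : ∀ {P : Set} (d : Dec P) w → P → unless d w ≡ 0
unless-yes (yes _) w p = refl
unless-yes (no ¬p) w p = contradiction p ¬p

unless-no : ∀ {P : Set} (d : Dec P) w → ¬ P → unless d w ≡ w
unless-no (yes p) w ¬p = contradiction p ¬p
unless-no (no _) w ¬p = refl

unless-≤ : ∀ {P : Set} (d : Dec P) w → unless d w ≤ w
unless-≤ (yes _) w = z≤n
unless-≤ (no _) w = ≤-refl

-- missedMass F t sums |T(s)|·2^{h_s} over the nodes s of t whose cluster avoids F, and
-- missedPath F t y sums 2^{h_s} over those of them on the path from t down to the leaf y.
mutual
  missedMass : List (Fin n) → Tree n h → ℕ
  missedMass F t = unless (hits? F (pts t)) (weight t) + missedMass↓ F t

  missedMass↓ : List (Fin n) → Tree n h → ℕ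
  missedMass↓ F (leaf _) = 0
  missedMass↓ F (node cs) = missedMassᴸ F (toList cs)

  missedMassᴸ : List (Fin n) → List (Tree n h) → ℕ
  missedMassᴸ F [] = 0
  missedMassᴸ F (c ∷ cs) = missedMass F c + missedMassᴸ F cs

mutual
  missedPath : List (Fin n) → Tree n h → Fin n → ℕ
  missedPath {h = h} F t y = unless (hits? F (pts t)) (2 ^ h) + missedPath↓ F t y

  missedPath↓ : List (Fin n) → Tree n h → Fin n → ℕ
  missedPath↓ F (leaf _) y = 0
  missedPath↓ F (node cs) y = missedPathᴸ F (toList cs) y

  missedPathᴸ : List (Fin n) → List (Tree n h) → Fin n → ℕ
  missedPathᴸ F [] y = 0
  missedPathᴸ F (c ∷ cs) y with y ∈? pts c
  ... | yes _ = missedPath F c y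
  ... | no _ = missedPathᴸ F cs y

missedPathᴸ-here : ∀ F (c : Tree n h) cs {y} → y ∈ pts c → missedPathᴸ F (c ∷ cs) y ≡ missedPath F c y
missedPathᴸ-here F c cs {y} y∈c with y ∈? pts c
... | yes _ = refl
... | no y∉c = contradiction y∈c y∉c

missedPathᴸ-there : ∀ F (c : Tree n h) cs {y} → y ∉ pts c → missedPathᴸ F (c ∷ cs) y ≡ missedPathᴸ F cs y
missedPathᴸ-there F c cs {y} y∉c with y ∈? pts c
... | yes y∈c = contradiction y∈c y∉c
... | no _ = refl

upCost+1≡2^ : ∀ h → upCost h + 1 ≡ 2 ^ h
upCost+1≡2^ zero = refl
upCost+1≡2^ (suc h) = begin
  upCost h + 2 ^ h + 1    ≡⟨ +-assoc (upCost h) (2 ^ h) 1 ⟩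
  upCost h + (2 ^ h + 1)  ≡⟨ cong (upCost h +_) (+-comm (2 ^ h) 1) ⟩
  upCost h + (1 + 2 ^ h)  ≡⟨ +-assoc (upCost h) 1 (2 ^ h) ⟨
  upCost h + 1 + 2 ^ h    ≡⟨ cong (_+ 2 ^ h) (upCost+1≡2^ h) ⟩
  2 ^ h + 2 ^ h           ≡⟨ cong (2 ^ h +_) (+-identityʳ (2 ^ h)) ⟨
  2 ^ suc h               ∎
  where open ≡-Reasoning

upCost-mono : ∀ {a b} → a ≤ b → upCost a ≤ upCost b
upCost-mono {zero} z≤n = z≤n
upCost-mono {suc a} (s≤s a≤b) = +-mono-≤ (upCost-mono a≤b) (^-monoʳ-≤ 2 a≤b)

¬Hits-++ˡ : ∀ F (xs : List (Fin n)) {ys} → ¬ Hits F (xs ++ ys) → ¬ Hits F xs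
¬Hits-++ˡ F xs ¬hit = ¬hit ∘ Any.++⁺ˡ

¬Hits-++ʳ : ∀ F (xs : List (Fin n)) {ys} → ¬ Hits F (xs ++ ys) → ¬ Hits F ys
¬Hits-++ʳ F xs ¬hit = ¬hit ∘ Any.++⁺ʳ xs

mutual
  missedPath-≤ : ∀ F (t : Tree n h) y → missedPath F t y ≤ upCost (suc h)
  missedPath-≤ {h = h} F t y = begin
    unless (hits? F (pts t)) (2 ^ h) + missedPath↓ F t y
      ≤⟨ +-mono-≤ (unless-≤ (hits? F (pts t)) (2 ^ h)) (missedPath↓-≤ F t y) ⟩
    2 ^ h + upCost h
      ≡⟨ +-comm (2 ^ h) (upCost h) ⟩
    upCost (suc h) ∎
    where open ≤-Reasoning

  missedPath↓-≤ : ∀ F (t : Tree n h) y → missedPath↓ F t y ≤ upCost h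
  missedPath↓-≤ F (leaf _) y = z≤n
  missedPath↓-≤ F (node cs) y = missedPathᴸ-≤ F (toList cs) y

  missedPathᴸ-≤ : ∀ F (cs : List (Tree n h)) y → missedPathᴸ F cs y ≤ upCost (suc h)
  missedPathᴸ-≤ F [] y = z≤n
  missedPathᴸ-≤ F (c ∷ cs) y with y ∈? pts c
  ... | yes _ = missedPath-≤ F c y
  ... | no _ = missedPathᴸ-≤ F cs y

mutual
  missedPath-missed : ∀ F (t : Tree n h) {y} → ¬ Hits F (pts t) → y ∈ pts t → upCost (suc h) ≤ missedPath F t y
  missedPath-missed {h = h} F t {y} ¬hit y∈t = begin
    upCost h + 2 ^ h           ≡⟨ +-comm (upCost h) (2 ^ h) ⟩
    2 ^ h + upCost h           ≤⟨ +-monoʳ-≤ (2 ^ h) (missedPath↓-missed F t ¬hit y∈t) ⟩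
    2 ^ h + missedPath↓ F t y  ≡⟨ cong (_+ missedPath↓ F t y) (unless-no (hits? F (pts t)) (2 ^ h) ¬hit) ⟨
    missedPath F t y           ∎
    where open ≤-Reasoning

  missedPath↓-missed : ∀ F (t : Tree n h) {y} → ¬ Hits F (pts t) → y ∈ pts t → upCost h ≤ missedPath↓ F t y
  missedPath↓-missed F (leaf _) _ _ = z≤n
  missedPath↓-missed F (node (c ∷ cs)) ¬hit y∈t = missedPathᴸ-missed F (c ∷ cs) ¬hit y∈t

  missedPathᴸ-missed : ∀ F (cs : List (Tree n h)) {y} → ¬ Hits F (ptsL cs) → y ∈ ptsL cs →
                       upCost (suc h) ≤ missedPathᴸ F cs y
  missedPathᴸ-missed F (c ∷ cs) {y} ¬hit y∈cs with y ∈? pts c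
  ... | yes y∈c = missedPath-missed F c (¬Hits-++ˡ F (pts c) ¬hit) y∈c
  ... | no y∉c = missedPathᴸ-missed F cs (¬Hits-++ʳ F (pts c) ¬hit) (∈-++-∉ˡ (pts c) y∉c y∈cs)

*-unless : ∀ {P : Set} (d : Dec P) a w → a * unless d w ≡ unless d (a * w)
*-unless (yes _) a w = *-zeroʳ a
*-unless (no _) a w = refl

mutual
  sum-missedPath : ∀ F (t : Tree n h) → Unique (pts t) → sum (map (missedPath F t) (pts t)) ≡ missedMass F t
  sum-missedPath {h = h} F t t! = begin
    sum (map (missedPath F t) (pts t))
      ≡⟨ sum-map-+ (const (unless hit (2 ^ h))) (missedPath↓ F t) (pts t) ⟩
    sum (map (const (unless hit (2 ^ h))) (pts t)) + sum (map (missedPath↓ F t) (pts t))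
      ≡⟨ cong₂ _+_ (trans (sum-map-const _ (pts t)) (*-unless hit (length (pts t)) (2 ^ h))) (sum-missedPath↓ F t t!) ⟩
    missedMass F t ∎
    where
    open ≡-Reasoning
    hit = hits? F (pts t)

  sum-missedPath↓ : ∀ F (t : Tree n h) → Unique (pts t) → sum (map (missedPath↓ F t) (pts t)) ≡ missedMass↓ F t
  sum-missedPath↓ F (leaf _) _ = refl
  sum-missedPath↓ F (node (c ∷ cs)) t! = sum-missedPathᴸ F (c ∷ cs) t!

  sum-missedPathᴸ : ∀ F (cs : List (Tree n h)) → Unique (ptsL cs) →
                    sum (map (missedPathᴸ F cs) (ptsL cs)) ≡ missedMassᴸ F cs
  sum-missedPathᴸ F [] _ = refl
  sum-missedPathᴸ F (c ∷ cs) cs! with Unique-++⁻ (pts c) cs!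
  ... | c! , cs!′ , c#cs = begin
    sum (map (missedPathᴸ F (c ∷ cs)) (pts c ++ ptsL cs))
      ≡⟨ sum-map-++ (missedPathᴸ F (c ∷ cs)) (pts c) (ptsL cs) ⟩
    sum (map (missedPathᴸ F (c ∷ cs)) (pts c)) + sum (map (missedPathᴸ F (c ∷ cs)) (ptsL cs))
      ≡⟨ cong₂ _+_ (sum-map-cong _ (pts c) (missedPathᴸ-here F c cs))
                   (sum-map-cong _ (ptsL cs) (λ y∈cs → missedPathᴸ-there F c cs (λ y∈c → c#cs (y∈c , y∈cs)))) ⟩
    sum (map (missedPath F c) (pts c)) + sum (map (missedPathᴸ F cs) (ptsL cs))
      ≡⟨ cong₂ _+_ (sum-missedPath F c c!) (sum-missedPathᴸ F cs cs!′) ⟩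
    missedMassᴸ F (c ∷ cs) ∎
    where open ≡-Reasoning

missedMass-≤ : ∀ F (t : Tree n h) → Unique (pts t) → missedMass F t ≤ 2 * weight t
missedMass-≤ {h = h} F t t! = begin
  missedMass F t                                     ≡⟨ sum-missedPath F t t! ⟨
  sum (map (missedPath F t) (pts t))                 ≤⟨ sum-map-mono _ (pts t) (λ {y} _ → missedPath-≤ F t y) ⟩
  sum (map (const (upCost (suc h))) (pts t))         ≡⟨ sum-map-const _ (pts t) ⟩
  length (pts t) * upCost (suc h)                    ≤⟨ *-monoʳ-≤ (length (pts t)) (m≤m+n (upCost (suc h)) 1) ⟩
  length (pts t) * (upCost (suc h) + 1)              ≡⟨ cong (length (pts t) *_) (upCost+1≡2^ (suc h)) ⟩
  length (pts t) * (2 * 2 ^ h)                       ≡⟨ *-assoc (length (pts t)) 2 (2 ^ h) ⟨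
  length (pts t) * 2 * 2 ^ h                         ≡⟨ cong (_* 2 ^ h) (*-comm (length (pts t)) 2) ⟩
  2 * length (pts t) * 2 ^ h                         ≡⟨ *-assoc 2 (length (pts t)) (2 ^ h) ⟩
  2 * weight t                                       ∎
  where open ≤-Reasoning

missedPathᴸ-nth : ∀ F (cs : List (Tree n h)) i {c y} → Unique (ptsL cs) → nth cs i ≡ just c → y ∈ pts c →
                  missedPathᴸ F cs y ≡ missedPath F c y
missedPathᴸ-nth F (c ∷ cs) zero _ refl y∈c = missedPathᴸ-here F c cs y∈c
missedPathᴸ-nth F (c ∷ cs) (suc i) cs! nth≡ y∈c′ with Unique-++⁻ (pts c) cs!
... | _ , cs!′ , c#cs = trans (missedPathᴸ-there F c cs (λ y∈c → c#cs (y∈c , nth-pts-⊆ cs i nth≡ y∈c′)))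
                              (missedPathᴸ-nth F cs i cs!′ nth≡ y∈c′)

missedPath-subAt : ∀ F (t : Tree n h) u {s : Tree n h′} {y} → Unique (pts t) → subAt t u ≡ just (h′ , s) →
                   y ∈ pts s → missedPath F s y ≤ missedPath F t y
missedPath-subAt F t [] _ refl _ = ≤-refl
missedPath-subAt F (node (c ∷ cs)) (i ∷ u) {s = s} {y} t! eq y∈s with nth (c ∷ cs) i in nth≡
... | just c′ = begin
  missedPath F s y                  ≤⟨ missedPath-subAt F c′ u (nth-Unique (c ∷ cs) i nth≡ t!) eq y∈s ⟩
  missedPath F c′ y                 ≡⟨ missedPathᴸ-nth F (c ∷ cs) i t! nth≡ (subAt-pts-⊆ c′ u eq y∈s) ⟨
  missedPathᴸ F (c ∷ cs) y          ≤⟨ m≤n+m _ _ ⟩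
  missedPath F (node (c ∷ cs)) y    ∎
  where open ≤-Reasoning

-- Distances in the tree

lcaL-both : ∀ d (c : Tree n h) cs {x y} → x ∈ pts c → y ∈ pts c → lcaL d (c ∷ cs) x y ≡ lcaLevel c x y
lcaL-both d c cs {x} {y} x∈c y∈c with x ∈? pts c | y ∈? pts c
... | yes _ | yes _ = refl
... | no x∉c | _ = contradiction x∈c x∉c
... | yes _ | no y∉c = contradiction y∈c y∉c

lcaL-skipʸ : ∀ d (c : Tree n h) cs {x y} → y ∉ pts c → lcaL d (c ∷ cs) x y ≡ lcaL d cs x y
lcaL-skipʸ d c cs {x} {y} y∉c with x ∈? pts c | y ∈? pts c
... | _ | yes y∈c = contradiction y∈c y∉c
... | yes _ | no _ = refl
... | no _ | no _ = refl

lcaL-absent : ∀ d (cs : List (Tree n h)) {x y} → y ∉ ptsL cs → lcaL d cs x y ≡ d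
lcaL-absent d [] _ = refl
lcaL-absent d (c ∷ cs) y∉cs =
  trans (lcaL-skipʸ d c cs (y∉cs ∘ ∈-++⁺ˡ)) (lcaL-absent d cs (y∉cs ∘ ∈-++⁺ʳ (pts c)))

mutual
  lcaLevel-≤ : ∀ (t : Tree n h) x y → lcaLevel t x y ≤ h
  lcaLevel-≤ (leaf _) x y = z≤n
  lcaLevel-≤ (node (c ∷ cs)) x y = lcaL-≤ (c ∷ cs) x y

  lcaL-≤ : ∀ (cs : List (Tree n h)) x y → lcaL (suc h) cs x y ≤ suc h
  lcaL-≤ [] x y = ≤-refl
  lcaL-≤ (c ∷ cs) x y with x ∈? pts c | y ∈? pts c
  ... | yes _ | yes _ = m≤n⇒m≤1+n (lcaLevel-≤ c x y)
  ... | yes _ | no _ = lcaL-≤ cs x y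
  ... | no _ | _ = lcaL-≤ cs x y

mutual
  missedPath-≤-lca : ∀ F (t : Tree n h) {x y} → Unique (pts t) → x ∈ F → x ∈ pts t → y ∈ pts t →
                     missedPath F t y ≤ upCost (lcaLevel t x y)
  missedPath-≤-lca F (leaf z) _ x∈F x∈t _ =
    ≤-trans (≤-reflexive (cong (_+ 0) (unless-yes (hits? F (z ∷ [])) 1 (lose x∈t x∈F)))) z≤n
  missedPath-≤-lca {h = suc h} F t@(node (c ∷ cs)) t! x∈F x∈t y∈t = begin
    unless (hits? F (pts t)) (2 ^ suc h) + missedPathᴸ F (c ∷ cs) _
      ≡⟨ cong (_+ missedPathᴸ F (c ∷ cs) _) (unless-yes (hits? F (pts t)) (2 ^ suc h) (lose x∈t x∈F)) ⟩
    missedPathᴸ F (c ∷ cs) _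
      ≤⟨ missedPathᴸ-≤-lca F (c ∷ cs) t! x∈F y∈t ⟩
    upCost (lcaL (suc h) (c ∷ cs) _ _) ∎
    where open ≤-Reasoning

  missedPathᴸ-≤-lca : ∀ F (cs : List (Tree n h)) {x y} → Unique (ptsL cs) → x ∈ F → y ∈ ptsL cs →
                      missedPathᴸ F cs y ≤ upCost (lcaL (suc h) cs x y)
  missedPathᴸ-≤-lca {h = h} F (c ∷ cs) {x} {y} cs! x∈F y∈cs
    with Unique-++⁻ (pts c) cs! | x ∈? pts c | y ∈? pts c
  ... | c! , _ , _ | yes x∈c | yes y∈c = missedPath-≤-lca F c c! x∈F x∈c y∈c
  ... | _ , _ , c#cs | no _ | yes y∈c =
    subst (λ l → missedPath F c y ≤ upCost l) (sym (lcaL-absent (suc h) cs λ y∈cs′ → c#cs (y∈c , y∈cs′)))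
          (missedPath-≤ F c y)
  ... | _ , cs!′ , _ | yes _ | no y∉c = missedPathᴸ-≤-lca F cs cs!′ x∈F (∈-++-∉ˡ (pts c) y∉c y∈cs)
  ... | _ , cs!′ , _ | no _ | no y∉c = missedPathᴸ-≤-lca F cs cs!′ x∈F (∈-++-∉ˡ (pts c) y∉c y∈cs)

mutual
  missedPath-attained : ∀ F (t : Tree n h) {x₀ y} → x₀ ∈ F → x₀ ∈ pts t → y ∈ pts t →
                        ∃ λ x → x ∈ F × x ∈ pts t × upCost (lcaLevel t x y) ≤ missedPath F t y
  missedPath-attained F (leaf _) {x₀} x₀∈F x₀∈t _ = x₀ , x₀∈F , x₀∈t , z≤n
  missedPath-attained {h = suc h} F t@(node (c ∷ cs)) {x₀} {y} x₀∈F x₀∈t y∈t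
    with missedPathᴸ-attained F (c ∷ cs) x₀∈F y∈t
  ... | x , x∈F , x∈ , close = x , x∈F , [ id , (λ { refl → x₀∈t }) ] x∈ ,
        ≤-trans close (m≤n+m (missedPathᴸ F (c ∷ cs) y) (unless (hits? F (pts t)) (2 ^ suc h)))

  missedPathᴸ-attained : ∀ F (cs : List (Tree n h)) {x₀ y} → x₀ ∈ F → y ∈ ptsL cs →
                         ∃ λ x → x ∈ F × (x ∈ ptsL cs ⊎ x ≡ x₀) × upCost (lcaL (suc h) cs x y) ≤ missedPathᴸ F cs y
  missedPathᴸ-attained {h = h} F (c ∷ cs) {x₀} {y} x₀∈F y∈cs with toSum (y ∈? pts c)
  ... | inj₁ y∈c with toSum (hits? F (pts c))
  ...   | inj₁ hit with find hit
  ...     | x₁ , x₁∈c , x₁∈F with missedPath-attained F c x₁∈F x₁∈c y∈c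
  ...       | x , x∈F , x∈c , close = x , x∈F , inj₁ (∈-++⁺ˡ x∈c) ,
              subst₂ (λ l d → upCost l ≤ d) (sym (lcaL-both (suc h) c cs x∈c y∈c))
                     (sym (missedPathᴸ-here F c cs y∈c)) close
  missedPathᴸ-attained {h = h} F (c ∷ cs) {x₀} {y} x₀∈F y∈cs | inj₁ y∈c | inj₂ miss =
    x₀ , x₀∈F , inj₂ refl , (begin
      upCost (lcaL (suc h) (c ∷ cs) x₀ y)  ≤⟨ upCost-mono (lcaL-≤ (c ∷ cs) x₀ y) ⟩
      upCost (suc h)                       ≤⟨ missedPath-missed F c miss y∈c ⟩
      missedPath F c y                     ≡⟨ missedPathᴸ-here F c cs y∈c ⟨
      missedPathᴸ F (c ∷ cs) y             ∎)
    where open ≤-Reasoning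
  missedPathᴸ-attained {h = h} F (c ∷ cs) {x₀} {y} x₀∈F y∈cs | inj₂ y∉c
    with missedPathᴸ-attained F cs x₀∈F (∈-++-∉ˡ (pts c) y∉c y∈cs)
  ... | x , x∈F , x∈ , close = x , x∈F , map₁ (∈-++⁺ʳ (pts c)) x∈ ,
        subst₂ (λ l d → upCost l ≤ d) (sym (lcaL-skipʸ (suc h) c cs y∉c))
               (sym (missedPathᴸ-there F c cs y∉c)) close

module _ {L} (T : Tree n L) (T-bij : LeafBijection T) where

  private
    T! = proj₁ T-bij
    ∈T = proj₂ T-bij

  nearestDistance≡2*missedPath : ∀ {F x₀} y → x₀ ∈ F → minList (map (λ x → ρT T x y) F) ≡ 2 * missedPath F T y
  nearestDistance≡2*missedPath {f ∷ F} {x₀} y x₀∈F with missedPath-attained (f ∷ F) T x₀∈F (∈T x₀) (∈T y)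
  ... | x , x∈F , _ , close = ≤-antisym
    (≤-trans (minList-≤ _ (∈-map⁺ (λ x → ρT T x y) x∈F)) (*-monoʳ-≤ 2 close))
    (≤-minList _ (∈-map⁺ (λ x → ρT T x y) x∈F) λ z∈ → further (∈-map⁻ (λ x → ρT T x y) z∈))
    where
    further : ∀ {z} → (∃ λ x → x ∈ f ∷ F × z ≡ ρT T x y) → 2 * missedPath (f ∷ F) T y ≤ z
    further (x , x∈F , refl) = *-monoʳ-≤ 2 (missedPath-≤-lca (f ∷ F) T T! x∈F (∈T x) (∈T y))

  allFin↭pts : allFin n ↭ pts T
  allFin↭pts = ∼bag⇒↭ (unique∧set⇒bag (Unique.allFin⁺ n) T! (mk⇔ (λ _ → ∈T _) (λ _ → ∈-allFin _)))

  cost≡2*missedMass : ∀ {F x₀} → x₀ ∈ F → cost T F ≡ 2 * missedMass F T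
  cost≡2*missedMass {F} x₀∈F = begin
    cost T F                                               ≡⟨ sum-map-cong _ (allFin n) (λ _ → nearestDistance≡2*missedPath _ x₀∈F) ⟩
    sum (map (λ y → 2 * missedPath F T y) (allFin n))      ≡⟨ sum-↭ (map⁺ _ allFin↭pts) ⟩
    sum (map (λ y → 2 * missedPath F T y) (pts T))         ≡⟨ sum-map-*ˡ (missedPath F T) 2 (pts T) ⟩
    2 * sum (map (missedPath F T) (pts T))                 ≡⟨ cong (2 *_) (sum-missedPath F T T!) ⟩
    2 * missedMass F T                                     ∎
    where open ≡-Reasoning

-- Exchanging one centre set for another

onlyIn : (G F xs : List (Fin n)) → List (Fin n)
onlyIn G F = filter (λ x → x ∈? G ×-dec ¬? (x ∈? F))

length-onlyIn-++ : ∀ G F (xs : List (Fin n)) ys →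
                   length (onlyIn G F (xs ++ ys)) ≡ length (onlyIn G F xs) + length (onlyIn G F ys)
length-onlyIn-++ G F xs ys = trans (cong length (filter-++ _ xs ys)) (length-++ (onlyIn G F xs))

-- Where F misses a node that G hits, F pays at most twice the node's weight, and G has a
-- point there that F lacks.
MissedNodesWeighAtMost : List (Fin n) → ℕ → Tree n h → Set
MissedNodesWeighAtMost {n} F m t = ∀ {h′} {s : Tree n h′} → s ≼ t → ¬ Hits F (pts s) → weight s ≤ m

module _ (F G : List (Fin n)) (m : ℕ) where

  mutual
    missedMass-exchange : ∀ (t : Tree n h) → Unique (pts t) →
                          MissedNodesWeighAtMost F m t →
                          missedMass F t ≤ missedMass G t + 2 * m * length (onlyIn G F (pts t))
    missedMass-exchange t t! light with toSum (hits? F (pts t))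
    ... | inj₁ hitF = begin
      missedMass F t                       ≡⟨ cong (_+ missedMass↓ F t) (unless-yes (hits? F (pts t)) (weight t) hitF) ⟩
      missedMass↓ F t                      ≤⟨ missedMass↓-exchange t t! light ⟩
      missedMass↓ G t + 2 * m * extra      ≤⟨ +-monoˡ-≤ (2 * m * extra) (m≤n+m _ (unless (hits? G (pts t)) (weight t))) ⟩
      missedMass G t + 2 * m * extra       ∎
      where
      open ≤-Reasoning
      extra = length (onlyIn G F (pts t))
    ... | inj₂ missF with toSum (hits? G (pts t))
    ...   | inj₁ hitG with find hitG
    ...     | g , g∈t , g∈G = begin
      missedMass F t                       ≤⟨ missedMass-≤ F t t! ⟩
      2 * weight t                         ≤⟨ *-monoʳ-≤ 2 (light ≼-refl missF) ⟩
      2 * m                                ≡⟨ *-identityʳ (2 * m) ⟨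
      2 * m * 1                            ≤⟨ *-monoʳ-≤ (2 * m) (filter-some _ (lose g∈t (g∈G , missF ∘ lose g∈t))) ⟩
      2 * m * length (onlyIn G F (pts t))  ≤⟨ m≤n+m _ _ ⟩
      missedMass G t + 2 * m * length (onlyIn G F (pts t)) ∎
      where open ≤-Reasoning
    missedMass-exchange t t! light | inj₂ missF | inj₂ missG = begin
      missedMass F t                              ≡⟨ cong (_+ missedMass↓ F t) (unless-no (hits? F (pts t)) (weight t) missF) ⟩
      weight t + missedMass↓ F t                  ≤⟨ +-monoʳ-≤ (weight t) (missedMass↓-exchange t t! light) ⟩
      weight t + (missedMass↓ G t + 2 * m * extra) ≡⟨ +-assoc (weight t) _ _ ⟨
      weight t + missedMass↓ G t + 2 * m * extra
        ≡⟨ cong (λ w → w + missedMass↓ G t + 2 * m * extra) (unless-no (hits? G (pts t)) (weight t) missG) ⟨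
      missedMass G t + 2 * m * extra              ∎
      where
      open ≤-Reasoning
      extra = length (onlyIn G F (pts t))

    missedMass↓-exchange : ∀ (t : Tree n h) → Unique (pts t) →
                           MissedNodesWeighAtMost F m t →
                           missedMass↓ F t ≤ missedMass↓ G t + 2 * m * length (onlyIn G F (pts t))
    missedMass↓-exchange (leaf _) _ _ = z≤n
    missedMass↓-exchange (node (c ∷ cs)) t! light =
      missedMassᴸ-exchange (c ∷ cs) t! (λ c∈ s≼c → light (≼-child s≼c c∈))

    missedMassᴸ-exchange : ∀ (cs : List (Tree n h)) → Unique (ptsL cs) →
                           (∀ {c} → c ∈ cs → MissedNodesWeighAtMost F m c) →
                           missedMassᴸ F cs ≤ missedMassᴸ G cs + 2 * m * length (onlyIn G F (ptsL cs))
    missedMassᴸ-exchange [] _ _ = z≤n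
    missedMassᴸ-exchange (c ∷ cs) cs! light with Unique-++⁻ (pts c) cs!
    ... | c! , cs!′ , _ = begin
      missedMass F c + missedMassᴸ F cs
        ≤⟨ +-mono-≤ (missedMass-exchange c c! (light (here refl))) (missedMassᴸ-exchange cs cs!′ (light ∘ there)) ⟩
      (missedMass G c + 2 * m * eᶜ) + (missedMassᴸ G cs + 2 * m * eᶜˢ)
        ≡⟨ +-interchange (missedMass G c) _ _ _ ⟩
      missedMassᴸ G (c ∷ cs) + (2 * m * eᶜ + 2 * m * eᶜˢ)
        ≡⟨ cong (missedMassᴸ G (c ∷ cs) +_) (*-distribˡ-+ (2 * m) eᶜ eᶜˢ) ⟨
      missedMassᴸ G (c ∷ cs) + 2 * m * (eᶜ + eᶜˢ)
        ≡⟨ cong (λ e → missedMassᴸ G (c ∷ cs) + 2 * m * e) (length-onlyIn-++ G F (pts c) (ptsL cs)) ⟨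
      missedMassᴸ G (c ∷ cs) + 2 * m * length (onlyIn G F (ptsL (c ∷ cs))) ∎
      where
      open ≤-Reasoning
      eᶜ = length (onlyIn G F (pts c))
      eᶜˢ = length (onlyIn G F (ptsL cs))

-- The subtree search

Antichain : List Address → Set
Antichain C = ∀ {u v} → u ∈ C → v ∈ C → ¬ ProperAncestor u v

record TopScoring (T : Tree n h) (C : List Address) : Set where
  field
    nodes     : ∀ {v} → v ∈ C → IsNode T v
    dominates : ∀ {w v} → IsNode T w → (∀ {c} → c ∈ C → ¬ w ⊑ c) → v ∈ C → score T w ≤ score T v

module _ {T : Tree n h} {k C C′} (st : SearchStep T k C C′) where
  open SearchStep st

  private
    C∪S = C ++ S

    C′⊆C∪S : ∀ {v} → v ∈ C′ → v ∈ C∪S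
    C′⊆C∪S = proj₁ ∘ Equivalence.to (C'-spec _)

  -- A deepest descendant of x in C ∪ S survives the pruning.
  searchStep-covers : ∀ {x} → x ∈ C∪S → ∃ λ c → c ∈ C′ × x ⊑ c
  searchStep-covers {x} x∈ = w , Equivalence.from (C'-spec w) (proj₁ w-props , deepest) , proj₂ w-props
    where
    below = filter (x ⊑?_) C∪S
    w = argmax length x below
    w-props : w ∈ C∪S × x ⊑ w
    w-props = argmax-all length (x∈ , ⊑-refl x)
                (All.tabulate (∈-filter⁻ (x ⊑?_) {xs = C∪S}))
    deepest : ¬ ∃ λ v → v ∈ C∪S × ProperAncestor w v
    deepest (v , v∈ , w<v) = <⇒≱ (ProperAncestor⇒length< w<v)
      (All.lookup (f[xs]≤f[argmax] {f = length} x below)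
                  (∈-filter⁺ (x ⊑?_) v∈ (⊑-trans (proj₂ w-props) (ProperAncestor⇒⊑ w<v))))

  searchStep-antichain : Antichain C′
  searchStep-antichain {u} u∈ v∈ u<v = proj₂ (Equivalence.to (C'-spec u) u∈) (_ , C′⊆C∪S v∈ , u<v)

  private
    above-no-C∪S : ∀ {w} → (∀ {c} → c ∈ C′ → ¬ w ⊑ c) → ∀ {x} → x ∈ C∪S → ¬ w ⊑ x
    above-no-C∪S w-free x∈ w⊑x with searchStep-covers x∈
    ... | c , c∈ , x⊑c = w-free c∈ (⊑-trans w⊑x x⊑c)

  searchStep-topScoring : TopScoring T C → TopScoring T C′
  searchStep-topScoring top = record { nodes = nodes′ ; dominates = dominates′ }
    where
    open TopScoring top
    nodes′ : ∀ {v} → v ∈ C′ → IsNode T v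
    nodes′ v∈ = [ nodes , proj₁ ∘ S-eligible _ ] (∈-++⁻ C (C′⊆C∪S v∈))
    dominates′ : ∀ {w v} → IsNode T w → (∀ {c} → c ∈ C′ → ¬ w ⊑ c) → v ∈ C′ → score T w ≤ score T v
    dominates′ {w} {v} w-node w-free v∈ with ∈-++⁻ C (C′⊆C∪S v∈)
    ... | inj₁ v∈C = dominates w-node (above-no-C∪S w-free ∘ ∈-++⁺ˡ) v∈C
    ... | inj₂ v∈S = S-highest w v eligible (λ w∈S → above-no-C∪S w-free (∈-++⁺ʳ C w∈S) (⊑-refl w)) v∈S
      where
      eligible : Eligible T C w
      eligible = w-node , (λ w∈C → above-no-C∪S w-free (∈-++⁺ˡ w∈C) (⊑-refl w))
               , (λ c c∈C w<c → above-no-C∪S w-free (∈-++⁺ˡ c∈C) (ProperAncestor⇒⊑ w<c))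

searchRun-topScoring : ∀ {T : Tree n h} {k C} → SearchRun T k C → TopScoring T C
searchRun-topScoring start = record { nodes = λ () ; dominates = λ _ _ () }
searchRun-topScoring (step run st) = searchStep-topScoring st (searchRun-topScoring run)

record SearchOutput (T : Tree n h) (k : ℕ) (C : List Address) : Set where
  field
    topScoring : TopScoring T C
    unique     : Unique C
    antichain  : Antichain C
    enough     : k ≤ length C

subtreeSearch-output : ∀ {T : Tree n h} {k C} → 1 ≤ k → SubtreeSearch T k C → SearchOutput T k C
subtreeSearch-output 1≤k (start , halted) = contradiction 1≤k halted
subtreeSearch-output 1≤k (step run st , halted) = record
  { topScoring = searchRun-topScoring (step run st)
  ; unique     = SearchStep.C'-unique st
  ; antichain  = searchStep-antichain st
  ; enough     = ≮⇒≥ halted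
  }

-- The approximation bound

choose : (G : List (Fin n)) → Fin n → List (Fin n) → Fin n
choose G d [] = d
choose G d (x ∷ xs) with x ∈? G
... | yes _ = x
... | no _ = choose G x xs

choose-∈ : ∀ G d {x} (xs : List (Fin n)) → x ∈ xs → choose G d xs ∈ xs
choose-∈ G d (x ∷ xs) _ = go x xs
  where
  go : ∀ x xs → choose G d (x ∷ xs) ∈ x ∷ xs
  go x xs with x ∈? G
  ... | yes _ = here refl
  go x [] | no _ = here refl
  go x (x′ ∷ xs) | no _ = there (go x′ xs)

choose-∈G : ∀ G d (xs : List (Fin n)) → Hits G xs → choose G d xs ∈ G
choose-∈G G d (x ∷ xs) hit with x ∈? G
... | yes x∈G = x∈G
choose-∈G G d (x ∷ xs) (here x∈G) | no x∉G = contradiction x∈G x∉G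
choose-∈G G d (x ∷ xs) (there hit) | no _ = choose-∈G G x xs hit

module Approximation {L} (T : Tree n L) (T-bij : LeafBijection T) {k C₁} (out : SearchOutput T k C₁)
                     {v₁} (v₁∈C₁ : v₁ ∈ C₁) where

  open SearchOutput out
  open TopScoring topScoring

  private
    T! = proj₁ T-bij

  subAt-C₁ : ∀ {v} → v ∈ C₁ → ∃ λ hs → subAt T v ≡ just hs
  subAt-C₁ {v} v∈ with subAt T v | nodes v∈
  ... | just hs | _ = hs , refl

  clusters-disjoint : ∀ {u v x} → u ∈ C₁ → v ∈ C₁ → x ∈ clusterAt T u → x ∈ clusterAt T v → u ≡ v
  clusters-disjoint {u} {v} u∈ v∈ x∈u x∈v with subAt-C₁ u∈ | subAt-C₁ v∈
  ... | _ , eqᵤ | _ , eqᵥ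
    with subAt-comparable T u v T! eqᵤ eqᵥ (subst (_ ∈_) (clusterAt-subAt T u eqᵤ) x∈u)
                                            (subst (_ ∈_) (clusterAt-subAt T v eqᵥ) x∈v)
  ... | inj₁ u⊑v = [ id , (λ u<v → contradiction u<v (antichain u∈ v∈)) ] (⊑⇒≡⊎ProperAncestor u⊑v)
  ... | inj₂ v⊑u = [ sym , (λ v<u → contradiction v<u (antichain v∈ u∈)) ] (⊑⇒≡⊎ProperAncestor v⊑u)

  m : ℕ
  m = minList (map (score T) C₁)

  m≤score : ∀ {v} → v ∈ C₁ → m ≤ score T v
  m≤score v∈ = minList-≤ _ (∈-map⁺ (score T) v∈)

  pick : List (Fin n) → Address → Fin n
  pick G v = choose G (proj₁ (pts-nonempty T)) (clusterAt T v)

  picks : List (Fin n) → List (Fin n)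
  picks G = map (pick G) C₁

  pick-∈ : ∀ G {v} → v ∈ C₁ → pick G v ∈ clusterAt T v
  pick-∈ G {v} v∈ with subAt-C₁ v∈
  ... | (_ , s) , eq with pts-nonempty s
  ...   | x , x∈s = choose-∈ G _ (clusterAt T v) (subst (x ∈_) (sym (clusterAt-subAt T v eq)) x∈s)

  OnePerCluster : List (Fin n) → Set
  OnePerCluster F = Pointwise (λ v x → x ∈ clusterAt T v) C₁ F

  picks-onePerCluster : ∀ G → OnePerCluster (picks G)
  picks-onePerCluster G = go id
    where
    go : ∀ {vs} → vs ⊆ C₁ → Pointwise (λ v x → x ∈ clusterAt T v) vs (map (pick G) vs)
    go {[]} _ = []
    go {v ∷ vs} vs⊆ = pick-∈ G (vs⊆ (here refl)) ∷ go (vs⊆ ∘ there)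

  -- A node that avoids all picks lies above no member of C₁, so it scores at most m.
  missedNodesWeighAtMost-picks : ∀ G → MissedNodesWeighAtMost (picks G) m T
  missedNodesWeighAtMost-picks G s≼T avoided with ≼⇒subAt s≼T
  ... | u , eq = subst (_≤ m) (score-subAt T u eq)
    (≤-minList _ (∈-map⁺ (score T) v₁∈C₁) λ z∈ → bound (∈-map⁻ (score T) z∈))
    where
    above-none : ∀ {v} → v ∈ C₁ → ¬ u ⊑ v
    above-none v∈ (d , refl) with subAt-C₁ v∈
    ... | _ , eqᵥ = avoided (lose (subAt-pts-⊆ _ d (trans (sym (subAt-++ T u d eq)) eqᵥ)
                                     (subst (_ ∈_) (clusterAt-subAt T (u ++ d) eqᵥ) (pick-∈ G v∈)))
                                   (∈-map⁺ (pick G) v∈))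
    bound : ∀ {z} → (∃ λ v → v ∈ C₁ × z ≡ score T v) → score T u ≤ z
    bound (v , v∈ , refl) = dominates (subst Is-just (sym eq) (Maybe.just _)) above-none v∈

  clusters-unique : Unique (concatMap (clusterAt T) C₁)
  clusters-unique = Unique-concatMap⁺ (clusterAt T) unique cluster-unique clusters-disjoint
    where
    cluster-unique : ∀ {v} → v ∈ C₁ → Unique (clusterAt T v)
    cluster-unique {v} v∈ with subAt-C₁ v∈
    ... | _ , eq = subst Unique (sym (clusterAt-subAt T v eq)) (subAt-Unique T v eq T!)

  clusters-⊆ : concatMap (clusterAt T) C₁ ⊆ pts T
  clusters-⊆ x∈ with ∈-concat⁻′ (map (clusterAt T) C₁) x∈
  ... | _ , x∈cl , cl∈ with ∈-map⁻ (clusterAt T) cl∈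
  ...   | v , _ , refl = clusterAt-⊆ T v x∈cl

  hitsAt? : ∀ G v → Dec (Hits G (clusterAt T v))
  hitsAt? G v = hits? G (clusterAt T v)

  missed : List (Fin n) → List Address
  missed G = filter (¬? ∘ hitsAt? G) C₁

  hit : List (Fin n) → List Address
  hit G = filter (hitsAt? G) C₁

  -- Each member of C₁ missed by G carries missed mass at least m inside its own cluster,
  -- and these clusters are disjoint.
  m*length-missed≤missedMass : ∀ G → m * length (missed G) ≤ missedMass G T
  m*length-missed≤missedMass G = begin
    m * length (missed G)                                   ≡⟨ *-comm m _ ⟩
    length (missed G) * m                                   ≡⟨ sum-map-const m (missed G) ⟨
    sum (map (const m) (missed G))                          ≤⟨ sum-map-mono _ (missed G) m≤local ⟩
    sum (map local (missed G))                              ≤⟨ sum-map-filter local _ C₁ ⟩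
    sum (map local C₁)                                      ≡⟨ sum-map-concatMap (missedPath G T) (clusterAt T) C₁ ⟨
    sum (map (missedPath G T) (concatMap (clusterAt T) C₁)) ≤⟨ sum-map-⊆ _≟ᶠ_ _ clusters-unique T! clusters-⊆ ⟩
    sum (map (missedPath G T) (pts T))                      ≡⟨ sum-missedPath G T T! ⟩
    missedMass G T                                          ∎
    where
    open ≤-Reasoning
    local : Address → ℕ
    local v = sum (map (missedPath G T) (clusterAt T v))
    m≤local : ∀ {v} → v ∈ missed G → m ≤ local v
    m≤local {v} v∈ with ∈-filter⁻ (¬? ∘ hitsAt? G) {xs = C₁} v∈
    ... | v∈C₁ , miss with subAt-C₁ v∈C₁
    ...   | (_ , s) , eq rewrite clusterAt-subAt T v eq = begin
      m                                   ≤⟨ m≤score v∈C₁ ⟩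
      score T v                           ≡⟨ score-subAt T v eq ⟩
      weight s                            ≡⟨ unless-no (hits? G (pts s)) (weight s) miss ⟨
      unless (hits? G (pts s)) (weight s) ≤⟨ m≤m+n _ _ ⟩
      missedMass G s                      ≡⟨ sum-missedPath G s (subAt-Unique T v eq T!) ⟨
      sum (map (missedPath G s) (pts s))  ≤⟨ sum-map-mono _ (pts s) (missedPath-subAt G T v T! eq) ⟩
      sum (map (missedPath G T) (pts s))  ∎

  -- Each hit member of C₁ contributes its own pick to G ∩ F; the points of G outside F are
  -- the rest of G, and |G| = k ≤ |C₁|.
  length-onlyIn≤length-missed : ∀ G → Unique G → length G ≡ k →
                                length (onlyIn G (picks G) (pts T)) ≤ length (missed G)
  length-onlyIn≤length-missed G G! |G|≡k = +-cancelˡ-≤ (length (hit G)) _ _ (begin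
    length (hit G) + length extra                ≡⟨ +-comm (length (hit G)) (length extra) ⟩
    length extra + length (hit G)                ≡⟨ cong (length extra +_) (length-map (pick G) (hit G)) ⟨
    length extra + length shared                 ≡⟨ length-++ extra ⟨
    length (extra ++ shared)                     ≤⟨ length-⊆ _≟ᶠ_ (Unique.++⁺ extra! shared! apart) G! ⊆G ⟩
    length G                                     ≡⟨ |G|≡k ⟩
    k                                            ≤⟨ enough ⟩
    length C₁                                    ≡⟨ length-filter-¬ (hitsAt? G) C₁ ⟨
    length (hit G) + length (missed G)           ∎)
    where
    open ≤-Reasoning
    extra = onlyIn G (picks G) (pts T)
    shared = map (pick G) (hit G)
    hit⊆C₁ : hit G ⊆ C₁
    hit⊆C₁ = proj₁ ∘ ∈-filter⁻ (hitsAt? G) {xs = C₁}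
    extra! : Unique extra
    extra! = Unique.filter⁺ _ T!
    shared! : Unique shared
    shared! = Unique-map⁺-locally (pick G) (Unique.filter⁺ _ unique) λ {u} {v} u∈ v∈ pick≡ →
      clusters-disjoint (hit⊆C₁ u∈) (hit⊆C₁ v∈) (pick-∈ G (hit⊆C₁ u∈))
                        (subst (_∈ clusterAt T v) (sym pick≡) (pick-∈ G (hit⊆C₁ v∈)))
    shared⊆picks : shared ⊆ picks G
    shared⊆picks y∈ with ∈-map⁻ (pick G) y∈
    ... | v , v∈ , refl = ∈-map⁺ (pick G) (hit⊆C₁ v∈)
    apart : Disjoint extra shared
    apart (x∈ , x∈′) = proj₂ (proj₂ (∈-filter⁻ _ {xs = pts T} x∈)) (shared⊆picks x∈′)
    ⊆G : extra ++ shared ⊆ G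
    ⊆G x∈ with ∈-++⁻ extra x∈
    ... | inj₁ x∈extra = proj₁ (proj₂ (∈-filter⁻ _ {xs = pts T} x∈extra))
    ... | inj₂ x∈shared with ∈-map⁻ (pick G) x∈shared
    ...   | v , v∈ , refl = choose-∈G G _ (clusterAt T v) (proj₂ (∈-filter⁻ (hitsAt? G) {xs = C₁} v∈))

  cost-picks≤3*cost : ∀ G {g} → Unique G → length G ≡ k → g ∈ G → cost T (picks G) ≤ 3 * cost T G
  cost-picks≤3*cost G G! |G|≡k g∈G = begin
    cost T (picks G)                      ≡⟨ cost≡2*missedMass T T-bij (∈-map⁺ (pick G) v₁∈C₁) ⟩
    2 * missedMass (picks G) T
      ≤⟨ *-monoʳ-≤ 2 (missedMass-exchange (picks G) G m T T! (missedNodesWeighAtMost-picks G)) ⟩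
    2 * (missedMass G T + 2 * m * extra)  ≡⟨ cong (λ e → 2 * (missedMass G T + e)) (*-assoc 2 m extra) ⟩
    2 * (missedMass G T + 2 * (m * extra)) ≤⟨ *-monoʳ-≤ 2 (+-monoʳ-≤ (missedMass G T) (*-monoʳ-≤ 2 extra-mass)) ⟩
    2 * (3 * missedMass G T)              ≡⟨ *-assoc 2 3 (missedMass G T) ⟨
    3 * 2 * missedMass G T                ≡⟨ *-assoc 3 2 (missedMass G T) ⟩
    3 * (2 * missedMass G T)              ≡⟨ cong (3 *_) (cost≡2*missedMass T T-bij g∈G) ⟨
    3 * cost T G                          ∎
    where
    open ≤-Reasoning
    extra = length (onlyIn G (picks G) (pts T))
    extra-mass : m * extra ≤ missedMass G T
    extra-mass = ≤-trans (*-monoʳ-≤ m (length-onlyIn≤length-missed G G! |G|≡k)) (m*length-missed≤missedMass G)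

  -- cost T cheapest is the paper's cost′^T_k(U)
  cheapest : List (Fin n)
  cheapest = argmin (cost T) (picks []) (choices (clusterAt T) C₁)

  cheapest-onePerCluster : OnePerCluster cheapest
  cheapest-onePerCluster with argmin-sel (cost T) (picks []) (choices (clusterAt T) C₁)
  ... | inj₁ ≡picks = subst OnePerCluster (sym ≡picks) (picks-onePerCluster [])
  ... | inj₂ ∈choices = ∈-choices⁻ (clusterAt T) C₁ ∈choices

  cheapest-≤ : ∀ {F} → OnePerCluster F → cost T cheapest ≤ cost T F
  cheapest-≤ F∈ = All.lookup (f[argmin]≤f[xs] {f = cost T} (picks []) (choices (clusterAt T) C₁))
                             (∈-choices⁺ (clusterAt T) F∈)

mainTheorem1 : ∀ (n L : ℕ) (T : Tree n L) → LeafBijection T →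
               ∀ (k : ℕ) → 1 ≤ k → ∀ (C₁ : List Address) → SubtreeSearch T k C₁ →
               ∃ λ (F : List (Fin n)) →
                 Pointwise (λ v x → x ∈ clusterAt T v) C₁ F ×
                 (∀ (G : List (Fin n)) → Unique G → length G ≡ k → cost T F ≤ 5 * cost T G)
mainTheorem1 n L T T-bij k 1≤k [] search =
  contradiction (≤-trans 1≤k (SearchOutput.enough (subtreeSearch-output 1≤k search))) λ ()
mainTheorem1 n L T T-bij k 1≤k C₁@(_ ∷ _) search = cheapest , cheapest-onePerCluster , bound
  where
  open Approximation T T-bij (subtreeSearch-output 1≤k search) (here refl)
  bound : ∀ G → Unique G → length G ≡ k → cost T cheapest ≤ 5 * cost T G
  bound [] _ |G|≡k = contradiction (subst (1 ≤_) (sym |G|≡k) 1≤k) λ ()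
  bound (g ∷ G) G! |G|≡k = begin
    cost T cheapest          ≤⟨ cheapest-≤ (picks-onePerCluster (g ∷ G)) ⟩
    cost T (picks (g ∷ G))   ≤⟨ cost-picks≤3*cost (g ∷ G) G! |G|≡k (here refl) ⟩
    3 * cost T (g ∷ G)       ≤⟨ *-monoˡ-≤ (cost T (g ∷ G)) (m≤m+n 3 2) ⟩
    5 * cost T (g ∷ G)       ∎
    where open ≤-Reasoning
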